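{- Let $n\ge 2$. There exist infinitely many symmetric matrices $Y_n=Y_n^T\in O_n(\mathbb{Q})$ with $\underline{Y_n}=S_nH_n$; that is, $(Y_n)_{i,j}\ne0$ if and only if $i+j\ge n$.
   Context: $O_n(\mathbb{Q})$ is the set of $n\times n$ real orthogonal matrices with rational entries and $\underline{Y}$ denotes the zero-pattern of $Y$ (the $(0,1)$-matrix with $1$ exactly where $Y$ is nonzero). $H_n$ is the $n\times n$ Hessenberg $(0,1)$-matrix with $(H_n)_{i,j}=1$ iff $j\ge i-1$, and $S_n$ is the antidiagonal permutation matrix (ones in positions $(i,n+1-i)$), so $(S_nH_n)_{i,j}=(H_n)_{n+1-i,j}$, which is $1$ iff $i+j\ge n$. -}

module Defs where

open import Data.Nat using (ℕ; zero; suc; _≤_) renaming (_+_ to _+ℕ_)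
open import Data.Fin using (Fin; toℕ; _≟_) renaming (zero to fzero; suc to fsuc)
open import Data.Rational using (ℚ; 0ℚ; 1ℚ; _+_; _*_)
open import Relation.Nullary using (¬_; yes; no)
open import Relation.Binary.PropositionalEquality using (_≡_)
open import Data.Product using (_×_)

Matrix : ℕ → Set
Matrix n = Fin n → Fin n → ℚ

∑ : ∀ {n} → (Fin n → ℚ) → ℚ
∑ {zero}  f = 0ℚ
∑ {suc n} f = f fzero + ∑ (λ i → f (fsuc i))

transpose : ∀ {n} → Matrix n → Matrix n
transpose Y i j = Y j i

_·_ : ∀ {n} → Matrix n → Matrix n → Matrix n
(A · B) i j = ∑ (λ k → A i k * B k j)

identity : ∀ {n} → Matrix n
identity i j with i ≟ j
... | yes _ = 1ℚ
... | no  _ = 0ℚ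

IsOrthogonal : ∀ {n} → Matrix n → Set
IsOrthogonal {n} Y = ∀ (i j : Fin n) → (transpose Y · Y) i j ≡ identity i j

IsSymmetric : ∀ {n} → Matrix n → Set
IsSymmetric {n} Y = ∀ (i j : Fin n) → Y i j ≡ transpose Y i j

-- Zero pattern of Y equals S_n H_n: with 1-based indices (i+1),(j+1),
-- Y i j ≠ 0 iff (i+1)+(j+1) ≥ n.
HasPatternSH : ∀ {n} → Matrix n → Set
HasPatternSH {n} Y =
  ∀ (i j : Fin n) → (¬ (Y i j ≡ 0ℚ) → n ≤ suc (toℕ i) +ℕ suc (toℕ j))
                  × (n ≤ suc (toℕ i) +ℕ suc (toℕ j) → ¬ (Y i j ≡ 0ℚ))

_≋_ : ∀ {n} → Matrix n → Matrix n → Set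
_≋_ {n} A B = ∀ (i j : Fin n) → A i j ≡ B i j

-- With c² + s² = 1 and c, s ≠ 0, let Y₁ = (1) and obtain Y_{N+1} from 1 ⊕ Y_N by moving
-- its first row e₀ down to position N-1 and rotating the last two rows by the Givens
-- rotation ((s , c) , (c , -s)).  Orthogonality of the columns is preserved at each step,
-- and unfolding the recursion gives the closed form
--   (Y_N)ᵢⱼ = 0 if (i+1)+(j+1) < N,   s if (i+1)+(j+1) = N,   wᵢ wⱼ (-s)ᵉ if (i+1)+(j+1) = N+1+e,
-- with wᵢ = 1 for the last index and c otherwise (0-based i, j).  The rational points
-- c = 2t/(t²+1), s = (t²-1)/(t²+1), t = 2, 3, …, give infinitely many such matrices.
module Submission where

open import Defs
open import Data.Nat using (ℕ; zero; suc; z≤n; s≤s; _≤_; _<_; _≤?_) renaming (_+_ to _+ℕ_; _*_ to _*ℕ_)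
import Data.Nat.Properties as ℕ
open import Data.Fin using (Fin; toℕ; _≟_; fromℕ; inject₁) renaming (zero to fzero)
import Data.Fin.Properties as Fin
open import Data.Rational using (ℚ; 0ℚ; 1ℚ; _+_; _*_; -_; _-_; 1/_; ½; ↧ₙ_; ≢-nonZero; toℚᵘ; Positive)
open import Data.Rational.Literals using (fromℤ)
open import Data.Rational.Properties
  using (+-comm; +-assoc; *-comm; *-assoc; *-identityʳ; *-zeroˡ; *-zeroʳ; +-identityˡ; *-inverseʳ; *-inverseˡ;
         neg-injective; pos*pos⇒pos; toℚᵘ-injective; toℚᵘ-homo-+; toℚᵘ-homo-*)
import Data.Rational.Unnormalised as ℚᵘ
import Data.Rational.Unnormalised.Properties as ℚᵘ
open import Data.Rational.Solver
open import Data.Product using (Σ; _×_; _,_)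
open import Data.Empty using (⊥-elim)
open import Function using (_∘_)
open import Relation.Nullary using (¬_; yes; no)
open import Relation.Binary.Definitions using (tri<; tri≈; tri>)
open import Relation.Binary.PropositionalEquality using (_≡_; _≢_; refl; sym; trans; cong; cong₂; subst; module ≡-Reasoning)
open +-*-Solver
open ≡-Reasoning

module ℤ where
  open import Data.Integer public using (ℤ; +_)
  open import Data.Integer.Solver using (module +-*-Solver)
  open Data.Integer.Solver.+-*-Solver public

sumUpTo : ℕ → (ℕ → ℚ) → ℚ
sumUpTo zero    g = 0ℚ
sumUpTo (suc n) g = g 0 + sumUpTo n (g ∘ suc)

∑≡sumUpTo : ∀ n (g : ℕ → ℚ) → ∑ {n} (g ∘ toℕ) ≡ sumUpTo n g
∑≡sumUpTo zero    g = refl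
∑≡sumUpTo (suc n) g = cong (g 0 +_) (∑≡sumUpTo n (g ∘ suc))

sumUpTo-suc : ∀ n g → sumUpTo (suc n) g ≡ sumUpTo n g + g n
sumUpTo-suc zero    g = +-comm (g 0) 0ℚ
sumUpTo-suc (suc n) g = trans (cong (g 0 +_) (sumUpTo-suc n (g ∘ suc))) (sym (+-assoc (g 0) _ _))

sumUpTo-suc-suc : ∀ n g → sumUpTo (suc (suc n)) g ≡ (sumUpTo n g + g n) + g (suc n)
sumUpTo-suc-suc n g = trans (sumUpTo-suc (suc n) g) (cong (_+ g (suc n)) (sumUpTo-suc n g))

sumUpTo-cong : ∀ n {g h : ℕ → ℚ} → (∀ k → k < n → g k ≡ h k) → sumUpTo n g ≡ sumUpTo n h
sumUpTo-cong zero    _   = refl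
sumUpTo-cong (suc n) g≡h = cong₂ _+_ (g≡h 0 (s≤s z≤n)) (sumUpTo-cong n (λ k k<n → g≡h (suc k) (s≤s k<n)))

sumUpTo-zero : ∀ n (g : ℕ → ℚ) → (∀ k → k < n → g k ≡ 0ℚ) → sumUpTo n g ≡ 0ℚ
sumUpTo-zero zero    g g≡0 = refl
sumUpTo-zero (suc n) g g≡0 =
  trans (cong₂ _+_ (g≡0 0 (s≤s z≤n)) (sumUpTo-zero n (g ∘ suc) (λ k k<n → g≡0 (suc k) (s≤s k<n))))
        (+-identityˡ 0ℚ)

*-≢0 : ∀ {a b : ℚ} → a ≢ 0ℚ → b ≢ 0ℚ → a * b ≢ 0ℚ
*-≢0 {a} {b} a≢0 b≢0 ab≡0 = a≢0 (begin
    a             ≡⟨ sym (*-identityʳ a) ⟩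
    a * 1ℚ        ≡⟨ cong (a *_) (sym (*-inverseʳ b {{≢-nonZero b≢0}})) ⟩
    a * (b * b⁻¹) ≡⟨ sym (*-assoc a b b⁻¹) ⟩
    (a * b) * b⁻¹ ≡⟨ cong (_* b⁻¹) ab≡0 ⟩
    0ℚ * b⁻¹      ≡⟨ *-zeroˡ b⁻¹ ⟩
    0ℚ            ∎)
  where
  b⁻¹ : ℚ
  b⁻¹ = (1/ b) {{≢-nonZero b≢0}}

-‿≢0 : ∀ {a : ℚ} → a ≢ 0ℚ → - a ≢ 0ℚ
-‿≢0 a≢0 = a≢0 ∘ neg-injective

diagOr : ℚ → ℕ → ℕ → ℚ
diagOr x zero    zero    = 1ℚ
diagOr x zero    (suc _) = x
diagOr x (suc _) zero    = x
diagOr x (suc a) (suc b) = diagOr x a b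

diagOr-refl : ∀ x a → diagOr x a a ≡ 1ℚ
diagOr-refl x zero    = refl
diagOr-refl x (suc a) = diagOr-refl x a

diagOr-≢ : ∀ x {a b} → a ≢ b → diagOr x a b ≡ x
diagOr-≢ x {zero}  {zero}  a≢b = ⊥-elim (a≢b refl)
diagOr-≢ x {zero}  {suc b} a≢b = refl
diagOr-≢ x {suc a} {zero}  a≢b = refl
diagOr-≢ x {suc a} {suc b} a≢b = diagOr-≢ x (a≢b ∘ cong suc)

diagOr-≢0 : ∀ {x} → x ≢ 0ℚ → ∀ a b → diagOr x a b ≢ 0ℚ
diagOr-≢0 x≢0 zero    zero    = λ ()
diagOr-≢0 x≢0 zero    (suc b) = x≢0
diagOr-≢0 x≢0 (suc a) zero    = x≢0
diagOr-≢0 x≢0 (suc a) (suc b) = diagOr-≢0 x≢0 a b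

identity≡diagOr0 : ∀ {n} (i j : Fin n) → identity i j ≡ diagOr 0ℚ (toℕ i) (toℕ j)
identity≡diagOr0 i j with i ≟ j
... | yes refl = sym (diagOr-refl 0ℚ (toℕ i))
... | no  i≢j  = sym (diagOr-≢ 0ℚ (i≢j ∘ Fin.toℕ-injective))

module Givens (c s : ℚ) where

  negPow : ℕ → ℚ
  negPow zero    = 1ℚ
  negPow (suc e) = (- s) * negPow e

  band : ℕ → ℕ → ℚ → ℚ
  band zero    zero    m = s
  band zero    (suc N) m = 0ℚ
  band (suc e) zero    m = m * negPow e
  band (suc a) (suc N) m = band a N m

  weight : ℕ → ℕ → ℚ
  weight N i = diagOr c (suc i) N

  entry : ℕ → ℕ → ℕ → ℚ
  entry N i j = band (suc i +ℕ suc j) N (weight N i * weight N j)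

  band-< : ∀ {a N} m → a < N → band a N m ≡ 0ℚ
  band-< {zero}  {suc N} m _         = refl
  band-< {suc a} {suc N} m (s≤s a<N) = band-< m a<N

  band-diagonal : ∀ N m → band N N m ≡ s
  band-diagonal zero    m = refl
  band-diagonal (suc N) m = band-diagonal N m

  band-+ : ∀ N e m → band (N +ℕ suc e) N m ≡ m * negPow e
  band-+ zero    e m = refl
  band-+ (suc N) e m = band-+ N e m

  module NonDegenerate (c≢0 : c ≢ 0ℚ) (s≢0 : s ≢ 0ℚ) where

    negPow-≢0 : ∀ e → negPow e ≢ 0ℚ
    negPow-≢0 zero    = λ ()
    negPow-≢0 (suc e) = *-≢0 (-‿≢0 s≢0) (negPow-≢0 e)

    band-≢0 : ∀ {a N m} → N ≤ a → m ≢ 0ℚ → band a N m ≢ 0ℚ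
    band-≢0 {zero}  {zero}  z≤n       m≢0 = s≢0
    band-≢0 {suc a} {zero}  z≤n       m≢0 = *-≢0 m≢0 (negPow-≢0 a)
    band-≢0 {suc a} {suc N} (s≤s N≤a) m≢0 = band-≢0 N≤a m≢0

    entry-≢0 : ∀ {N} i j → N ≤ suc i +ℕ suc j → entry N i j ≢ 0ℚ
    entry-≢0 {N} i j N≤ = band-≢0 N≤ (*-≢0 (diagOr-≢0 c≢0 (suc i) N) (diagOr-≢0 c≢0 (suc j) N))

  entry-symmetric : ∀ N i j → entry N i j ≡ entry N j i
  entry-symmetric N i j = cong₂ (λ a → band a N) (ℕ.+-comm (suc i) (suc j)) (*-comm (weight N i) (weight N j))

  entry-before : ∀ N i j → suc i +ℕ suc j < N → entry N i j ≡ 0ℚ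
  entry-before N i j = band-< _

  entry-antidiagonal : ∀ N i j → suc i +ℕ suc j ≡ N → entry N i j ≡ s
  entry-antidiagonal N i j refl = band-diagonal N _

  entry-beyond : ∀ N i j e → suc i +ℕ suc j ≡ N +ℕ suc e → entry N i j ≡ (weight N i * weight N j) * negPow e
  entry-beyond N i j e eq = trans (cong (λ a → band a N (weight N i * weight N j)) eq) (band-+ N e _)

  weight-last : ∀ m → weight (suc m) m ≡ 1ℚ
  weight-last m = diagOr-refl c m

  weight-inner : ∀ {m i} → i < m → weight (suc m) i ≡ c
  weight-inner i<m = diagOr-≢ c (ℕ.<⇒≢ (s≤s i<m))

  -- How the rows of Y_{m+2} arise from those of Y_{m+1}; the column index is shifted
  -- because Y_{m+2} is built from 1 ⊕ Y_{m+1}.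
  module Recursion (m : ℕ) where

    upper-shift : ∀ {i} j → i < m → entry (suc (suc m)) i (suc j) ≡ entry (suc m) i j
    upper-shift {i} j i<m = cong₂ (λ a w → band a (suc m) (w * weight (suc m) j)) (ℕ.+-suc i (suc j))
      (trans (weight-inner (ℕ.m<n⇒m<1+n i<m)) (sym (weight-inner i<m)))

    upper-first : ∀ {i} → i < m → entry (suc (suc m)) i 0 ≡ 0ℚ
    upper-first {i} i<m = entry-before (suc (suc m)) i 0 (s≤s (subst (_< suc m) (ℕ.+-comm 1 i) (s≤s i<m)))

    penultimate-first : entry (suc (suc m)) m 0 ≡ s
    penultimate-first = entry-antidiagonal (suc (suc m)) m 0 (cong suc (ℕ.+-comm m 1))

    penultimate-shift : ∀ j → entry (suc (suc m)) m (suc j) ≡ c * entry (suc m) m j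
    penultimate-shift j = begin
      entry M m (suc j)                 ≡⟨ entry-beyond M m (suc j) j (cong suc (ℕ.+-suc m (suc j))) ⟩
      (weight M m * w) * negPow j        ≡⟨ cong (λ x → (x * w) * negPow j) (weight-inner (ℕ.n<1+n m)) ⟩
      (c * w) * negPow j                 ≡⟨ solve 3 (λ C W P → (C :* W) :* P := C :* ((con 1ℚ :* W) :* P)) refl c w (negPow j) ⟩
      c * ((1ℚ * w) * negPow j)          ≡⟨ cong (λ x → c * ((x * w) * negPow j)) (sym (weight-last m)) ⟩
      c * ((weight (suc m) m * w) * negPow j) ≡⟨ cong (c *_) (sym (entry-beyond (suc m) m j j refl)) ⟩
      c * entry (suc m) m j              ∎
      where
      M : ℕ
      M = suc (suc m)
      w : ℚ
      w = weight (suc m) j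

    last-first : entry (suc (suc m)) (suc m) 0 ≡ c
    last-first = begin
      entry M (suc m) 0              ≡⟨ entry-beyond M (suc m) 0 0 refl ⟩
      (weight M (suc m) * c) * 1ℚ    ≡⟨ cong (λ x → (x * c) * 1ℚ) (weight-last (suc m)) ⟩
      (1ℚ * c) * 1ℚ                  ≡⟨ solve 1 (λ C → (con 1ℚ :* C) :* con 1ℚ := C) refl c ⟩
      c                              ∎
      where
      M : ℕ
      M = suc (suc m)

    last-shift : ∀ j → entry (suc (suc m)) (suc m) (suc j) ≡ (- s) * entry (suc m) m j
    last-shift j = begin
      entry M (suc m) (suc j)             ≡⟨ entry-beyond M (suc m) (suc j) (suc j) refl ⟩
      (weight M (suc m) * w) * ((- s) * negPow j) ≡⟨ cong (λ x → (x * w) * ((- s) * negPow j)) (weight-last (suc m)) ⟩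
      (1ℚ * w) * ((- s) * negPow j)       ≡⟨ solve 3 (λ S W P → (con 1ℚ :* W) :* ((:- S) :* P) := (:- S) :* ((con 1ℚ :* W) :* P)) refl s w (negPow j) ⟩
      (- s) * ((1ℚ * w) * negPow j)       ≡⟨ cong (λ x → (- s) * ((x * w) * negPow j)) (sym (weight-last m)) ⟩
      (- s) * ((weight (suc m) m * w) * negPow j) ≡⟨ cong ((- s) *_) (sym (entry-beyond (suc m) m j j refl)) ⟩
      (- s) * entry (suc m) m j           ∎
      where
      M : ℕ
      M = suc (suc m)
      w : ℚ
      w = weight (suc m) j

  columnDot : ℕ → ℕ → ℕ → ℚ
  columnDot N p q = sumUpTo N (λ k → entry N k p * entry N k q)

  columnDot-comm : ∀ N p q → columnDot N p q ≡ columnDot N q p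
  columnDot-comm N p q = sumUpTo-cong N (λ k _ → *-comm (entry N k p) (entry N k q))

  module Orthonormal (c²+s²≡1 : c * c + s * s ≡ 1ℚ) where

    givens-preserves-* : ∀ a b → (c * a) * (c * b) + ((- s) * a) * ((- s) * b) ≡ a * b
    givens-preserves-* a b = begin
      (c * a) * (c * b) + ((- s) * a) * ((- s) * b)
        ≡⟨ solve 4 (λ C S A B → (C :* A) :* (C :* B) :+ ((:- S) :* A) :* ((:- S) :* B)
                               := (C :* C :+ S :* S) :* (A :* B)) refl c s a b ⟩
      (c * c + s * s) * (a * b) ≡⟨ cong (_* (a * b)) c²+s²≡1 ⟩
      1ℚ * (a * b)              ≡⟨ solve 1 (λ X → con 1ℚ :* X := X) refl (a * b) ⟩
      a * b                     ∎

    module Step (m : ℕ) where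
      open Recursion m

      M : ℕ
      M = suc (suc m)

      sum-upper-first : ∀ q → sumUpTo m (λ k → entry M k 0 * entry M k q) ≡ 0ℚ
      sum-upper-first q = sumUpTo-zero m _ λ k k<m →
        trans (cong (_* entry M k q) (upper-first k<m)) (*-zeroˡ (entry M k q))

      first-first : columnDot M 0 0 ≡ 1ℚ
      first-first = begin
        columnDot M 0 0
          ≡⟨ sumUpTo-suc-suc m _ ⟩
        (sumUpTo m _ + entry M m 0 * entry M m 0) + entry M (suc m) 0 * entry M (suc m) 0
          ≡⟨ cong₂ _+_ (cong₂ _+_ (sum-upper-first 0) (cong₂ _*_ penultimate-first penultimate-first))
                       (cong₂ _*_ last-first last-first) ⟩
        (0ℚ + s * s) + c * c
          ≡⟨ solve 2 (λ C S → (con 0ℚ :+ S :* S) :+ C :* C := C :* C :+ S :* S) refl c s ⟩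
        c * c + s * s
          ≡⟨ c²+s²≡1 ⟩
        1ℚ ∎

      first-shift : ∀ q → columnDot M 0 (suc q) ≡ 0ℚ
      first-shift q = begin
        columnDot M 0 (suc q)
          ≡⟨ sumUpTo-suc-suc m _ ⟩
        (sumUpTo m _ + entry M m 0 * entry M m (suc q)) + entry M (suc m) 0 * entry M (suc m) (suc q)
          ≡⟨ cong₂ _+_ (cong₂ _+_ (sum-upper-first (suc q)) (cong₂ _*_ penultimate-first (penultimate-shift q)))
                       (cong₂ _*_ last-first (last-shift q)) ⟩
        (0ℚ + s * (c * b)) + c * ((- s) * b)
          ≡⟨ solve 3 (λ C S B → (con 0ℚ :+ S :* (C :* B)) :+ C :* ((:- S) :* B) := con 0ℚ) refl c s b ⟩
        0ℚ ∎
        where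
        b : ℚ
        b = entry (suc m) m q

      shift-shift : ∀ p q → columnDot M (suc p) (suc q) ≡ columnDot (suc m) p q
      shift-shift p q = begin
        columnDot M (suc p) (suc q)
          ≡⟨ sumUpTo-suc-suc m _ ⟩
        (sumUpTo m _ + entry M m (suc p) * entry M m (suc q)) + entry M (suc m) (suc p) * entry M (suc m) (suc q)
          ≡⟨ cong₂ _+_ (cong₂ _+_ (sumUpTo-cong m λ k k<m → cong₂ _*_ (upper-shift p k<m) (upper-shift q k<m))
                                  (cong₂ _*_ (penultimate-shift p) (penultimate-shift q)))
                       (cong₂ _*_ (last-shift p) (last-shift q)) ⟩
        (upper + (c * a) * (c * b)) + ((- s) * a) * ((- s) * b)
          ≡⟨ +-assoc upper _ _ ⟩
        upper + ((c * a) * (c * b) + ((- s) * a) * ((- s) * b))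
          ≡⟨ cong (upper +_) (givens-preserves-* a b) ⟩
        upper + a * b
          ≡⟨ sym (sumUpTo-suc m _) ⟩
        columnDot (suc m) p q ∎
        where
        a b upper : ℚ
        a = entry (suc m) m p
        b = entry (suc m) m q
        upper = sumUpTo m (λ k → entry (suc m) k p * entry (suc m) k q)

    columnDot-orthonormal : ∀ m p q → p < suc m → q < suc m → columnDot (suc m) p q ≡ diagOr 0ℚ p q
    columnDot-orthonormal zero    zero    zero    _         _         = refl
    columnDot-orthonormal zero    (suc p) _       (s≤s ())  _
    columnDot-orthonormal zero    _       (suc q) _         (s≤s ())
    columnDot-orthonormal (suc m) zero    zero    _         _         = Step.first-first m
    columnDot-orthonormal (suc m) zero    (suc q) _         _         = Step.first-shift m q
    columnDot-orthonormal (suc m) (suc p) zero    _         _         =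
      trans (columnDot-comm (suc (suc m)) (suc p) 0) (Step.first-shift m p)
    columnDot-orthonormal (suc m) (suc p) (suc q) (s≤s p<1+m) (s≤s q<1+m) =
      trans (Step.shift-shift m p q) (columnDot-orthonormal m p q p<1+m q<1+m)

  Y : (N : ℕ) → Matrix N
  Y N i j = entry N (toℕ i) (toℕ j)

  Y-symmetric : ∀ N → IsSymmetric (Y N)
  Y-symmetric N i j = entry-symmetric N (toℕ i) (toℕ j)

  Y-orthogonal : c * c + s * s ≡ 1ℚ → ∀ N → IsOrthogonal (Y N)
  Y-orthogonal c²+s²≡1 (suc m) i j = begin
    (transpose (Y (suc m)) · Y (suc m)) i j ≡⟨ ∑≡sumUpTo (suc m) (λ k → entry (suc m) k (toℕ i) * entry (suc m) k (toℕ j)) ⟩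
    columnDot (suc m) (toℕ i) (toℕ j)       ≡⟨ Orthonormal.columnDot-orthonormal c²+s²≡1 m _ _ (Fin.toℕ<n i) (Fin.toℕ<n j) ⟩
    diagOr 0ℚ (toℕ i) (toℕ j)               ≡⟨ sym (identity≡diagOr0 i j) ⟩
    identity i j                            ∎

  Y-pattern : c ≢ 0ℚ → s ≢ 0ℚ → ∀ N → HasPatternSH (Y N)
  Y-pattern c≢0 s≢0 N i j = nonZero⇒beyond , NonDegenerate.entry-≢0 c≢0 s≢0 (toℕ i) (toℕ j)
    where
    nonZero⇒beyond : ¬ (Y N i j ≡ 0ℚ) → N ≤ suc (toℕ i) +ℕ suc (toℕ j)
    nonZero⇒beyond Yij≢0 with N ≤? suc (toℕ i) +ℕ suc (toℕ j)
    ... | yes N≤ = N≤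
    ... | no  N≰ = ⊥-elim (Yij≢0 (entry-before N (toℕ i) (toℕ j) (ℕ.≰⇒> N≰)))

  Y-antidiagonal-first : ∀ m → Y (suc (suc m)) fzero (inject₁ (fromℕ m)) ≡ s
  Y-antidiagonal-first m =
    entry-antidiagonal (suc (suc m)) 0 _ (cong (suc ∘ suc) (trans (Fin.toℕ-inject₁ (fromℕ m)) (Fin.toℕ-fromℕ m)))

square-injective : ∀ {a b} → a *ℕ a ≡ b *ℕ b → a ≡ b
square-injective {a} {b} a²≡b² with ℕ.<-cmp a b
... | tri< a<b _ _ = ⊥-elim (ℕ.<-irrefl a²≡b² (ℕ.*-mono-< a<b a<b))
... | tri≈ _ a≡b _ = a≡b
... | tri> _ _ b<a = ⊥-elim (ℕ.<-irrefl (sym a²≡b²) (ℕ.*-mono-< b<a b<a))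

module CirclePoint (k : ℕ) where

  t : ℕ
  t = suc (suc k)

  T : ℚ
  T = fromℤ (ℤ.+ t)

  Q : ℚ
  Q = fromℤ (ℤ.+ suc (t *ℕ t))

  -- ↧ₙ q reduces to t² + 1; this is how q determines t.
  q : ℚ
  q = 1/ Q

  cos : ℚ
  cos = (1ℚ + 1ℚ) * T * q

  sin : ℚ
  sin = 1ℚ - (1ℚ + 1ℚ) * q

  T²+1≡Q : T * T + 1ℚ ≡ Q
  T²+1≡Q = toℚᵘ-injective (ℚᵘ.≃-trans (toℚᵘ-homo-+ (T * T) 1ℚ)
      (ℚᵘ.≃-trans (ℚᵘ.+-congˡ (toℚᵘ 1ℚ) (toℚᵘ-homo-* T T))
        (ℚᵘ.*≡* (ℤ.solve 1 (λ x → ((x ℤ.:* x) ℤ.:* ℤ.con 1ℤ ℤ.:+ ℤ.con 1ℤ ℤ.:* ℤ.con 1ℤ) ℤ.:* ℤ.con 1ℤ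
                                    ℤ.:= (ℤ.con 1ℤ ℤ.:+ x ℤ.:* x) ℤ.:* ℤ.con 1ℤ) refl (ℤ.+ t)))))
    where
    1ℤ : ℤ.ℤ
    1ℤ = ℤ.+ 1

  cos²+sin²≡1 : cos * cos + sin * sin ≡ 1ℚ
  cos²+sin²≡1 = begin
    cos * cos + sin * sin
      ≡⟨ solve 2 (λ T q → two :* T :* q :* (two :* T :* q) :+ (con 1ℚ :- two :* q) :* (con 1ℚ :- two :* q)
                         := con 1ℚ :+ two :* two :* q :* (q :* (T :* T :+ con 1ℚ) :- con 1ℚ)) refl T q ⟩
    1ℚ + 4q * (q * (T * T + 1ℚ) - 1ℚ) ≡⟨ cong (λ x → 1ℚ + 4q * (q * x - 1ℚ)) T²+1≡Q ⟩
    1ℚ + 4q * (q * Q - 1ℚ)            ≡⟨ cong (λ x → 1ℚ + 4q * (x - 1ℚ)) (*-inverseˡ Q) ⟩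
    1ℚ + 4q * 0ℚ                      ≡⟨ cong (1ℚ +_) (*-zeroʳ 4q) ⟩
    1ℚ                                ∎
    where
    two : Polynomial 2
    two = con 1ℚ :+ con 1ℚ
    4q : ℚ
    4q = (1ℚ + 1ℚ) * (1ℚ + 1ℚ) * q

  cos>0 : Positive cos
  cos>0 = pos*pos⇒pos ((1ℚ + 1ℚ) * T) {{pos*pos⇒pos (1ℚ + 1ℚ) T}} q

  cos≢0 : cos ≢ 0ℚ
  cos≢0 cos≡0 with subst Positive cos≡0 cos>0
  ... | ()

  q≡[1-sin]/2 : q ≡ (1ℚ - sin) * ½
  q≡[1-sin]/2 = sym (trans (solve 2 (λ q h → (con 1ℚ :- (con 1ℚ :- (con 1ℚ :+ con 1ℚ) :* q)) :* h
                                              := q :* ((con 1ℚ :+ con 1ℚ) :* h)) refl q ½)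
                           (*-identityʳ q))

  sin≢0 : sin ≢ 0ℚ
  sin≢0 sin≡0 = Q≢2 (cong ↧ₙ_ (trans q≡[1-sin]/2 (cong (λ x → (1ℚ - x) * ½) sin≡0)))
    where
    Q≢2 : suc (t *ℕ t) ≢ 2
    Q≢2 ()

sin-injective : ∀ {k l} → CirclePoint.sin k ≡ CirclePoint.sin l → k ≡ l
sin-injective {k} {l} sinₖ≡sinₗ =
  ℕ.suc-injective (ℕ.suc-injective (square-injective (ℕ.suc-injective (cong ↧ₙ_ qₖ≡qₗ))))
  where
  qₖ≡qₗ : CirclePoint.q k ≡ CirclePoint.q l
  qₖ≡qₗ = trans (CirclePoint.q≡[1-sin]/2 k)
            (trans (cong (λ x → (1ℚ - x) * ½) sinₖ≡sinₗ) (sym (CirclePoint.q≡[1-sin]/2 l)))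

mainTheorem11 : (n : ℕ) → 2 ≤ n →
    Σ (ℕ → Matrix n) (λ Y →
      (∀ k → IsSymmetric (Y k) × IsOrthogonal (Y k) × HasPatternSH (Y k))
      × (∀ k l → Y k ≋ Y l → k ≡ l))
mainTheorem11 n@(suc (suc m)) (s≤s (s≤s z≤n)) = Yₖ , properties , Yₖ-injective
  where
  open Givens
  open CirclePoint

  Yₖ : ℕ → Matrix n
  Yₖ k = Y (cos k) (sin k) n

  properties : ∀ k → IsSymmetric (Yₖ k) × IsOrthogonal (Yₖ k) × HasPatternSH (Yₖ k)
  properties k = Y-symmetric (cos k) (sin k) n
               , Y-orthogonal (cos k) (sin k) (cos²+sin²≡1 k) n
               , Y-pattern (cos k) (sin k) (cos≢0 k) (sin≢0 k) n

  Yₖ-injective : ∀ k l → Yₖ k ≋ Yₖ l → k ≡ l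
  Yₖ-injective k l Yₖ≋Yₗ = sin-injective (begin
    sin k                          ≡⟨ sym (Y-antidiagonal-first (cos k) (sin k) m) ⟩
    Yₖ k fzero (inject₁ (fromℕ m)) ≡⟨ Yₖ≋Yₗ fzero (inject₁ (fromℕ m)) ⟩
    Yₖ l fzero (inject₁ (fromℕ m)) ≡⟨ Y-antidiagonal-first (cos l) (sin l) m ⟩
    sin l                          ∎)
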